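{- Let $(\mathbb{V},\mathbb{F},+,\cdot)$ be a vector space and $\mathcal{K}=\{+\}\cup\{f_r:r\in\mathbb{F},r\neq0\}$, where $f_r:\mathbb{V}\to\mathbb{V}$, $f_r(v)=r\cdot v$. Then a function $f$ belongs to $\mathrm{OT}(\mathcal{K})$ if and only if $f:\mathbb{V}^n\to\mathbb{V}$ (for some $n\ge1$) is given by $f(x_1,\dots,x_n)=\sum_{i=1}^n r_i\cdot x_i$ for some nonzero scalars $r_1,\dots,r_n$.
   Context: $(\mathbb{V},\mathcal{K})$ is a homogeneous algebra. Orderly terms $\mathrm{OT}(\mathcal{K})$: the smallest collection of functions containing $\mathcal{K}$ and $\mathrm{id}_\mathbb{V}$ and closed under: if $g\in\mathcal{K}$ is $k$-ary and $h_1,\dots,h_k$ are orderly terms of arities $n_1,\dots,n_k$, then $f(\bar x_1,\dots,\bar x_k)=g(h_1(\bar x_1),\dots,h_k(\bar x_k))$ is an orderly term, where $\bar x_1,\dots,\bar x_k$ are consecutive disjoint blocks of $n_1,\dots,n_k$ variables. -}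

module Defs where

open import Level using (Level; _⊔_) renaming (suc to lsuc)
open import Data.Nat using (ℕ; zero; _+_)
open import Data.Fin using (Fin; zero; suc)
open import Data.Nat.Base using (suc)
open import Data.Product using (Σ)
open import Function using (_∘_)
open import Relation.Nullary using (¬_)
open import Algebra.Bundles using (CommutativeRing)
open import Algebra.Module.Bundles using (Module)
open import Data.Vec.Functional using (Vector; take; drop)

record Field (c ℓ : Level) : Set (lsuc (c ⊔ ℓ)) where
  field
    commutativeRing : CommutativeRing c ℓ
  open CommutativeRing commutativeRing public
  field
    0≉1     : ¬ (0# ≈ 1#)
    inverse : ∀ x → ¬ (x ≈ 0#) → Σ Carrier (λ y → x * y ≈ 1#)

VectorSpace : ∀ {c ℓ} (F : Field c ℓ) (m ℓm : Level) → Set (c ⊔ ℓ ⊔ lsuc (m ⊔ ℓm))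
VectorSpace F m ℓm = Module (Field.commutativeRing F) m ℓm

record HomAlgebra (v o : Level) : Set (lsuc (v ⊔ o)) where
  field
    V     : Set v
    Op    : Set o
    arity : Op → ℕ
    ⟦_⟧op : (g : Op) → Vector V (arity g) → V

ΣN : ∀ {k} → (Fin k → ℕ) → ℕ
ΣN {zero}  ns = 0
ΣN {suc k} ns = ns zero + ΣN (ns ∘ suc)

blocks : ∀ {a} {A : Set a} {k} (ns : Fin k → ℕ) → Vector A (ΣN ns) → (i : Fin k) → Vector A (ns i)
blocks ns xs zero    = take (ns zero) xs
blocks ns xs (suc i) = blocks (ns ∘ suc) (drop (ns zero) xs) i

module _ {v o} (𝔸 : HomAlgebra v o) where
  open HomAlgebra 𝔸

  -- syntax of orderly terms, indexed by their arity:
  --  * id_V is an orderly term of arity 1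
  --  * if g ∈ K is k-ary and h₁,…,h_k are orderly terms of arities n₁,…,n_k,
  --    then g(h₁(x̄₁),…,h_k(x̄_k)) (disjoint consecutive blocks) is of arity Σ nᵢ
  data OTerm : ℕ → Set o where
    idT  : OTerm 1
    node : (g : Op) (ns : Fin (arity g) → ℕ) → ((i : Fin (arity g)) → OTerm (ns i)) → OTerm (ΣN ns)

  ⟦_⟧T : ∀ {n} → OTerm n → Vector V n → V
  ⟦ idT ⟧T          xs = xs zero
  ⟦ node g ns ts ⟧T xs = ⟦ g ⟧op (λ i → ⟦ ts i ⟧T (blocks ns xs i))

  InOT : ∀ {ℓ} (_≈_ : V → V → Set ℓ) {n} → (Vector V n → V) → Set (v ⊔ o ⊔ ℓ)
  InOT _≈_ {n} f = Σ (OTerm n) (λ t → ∀ xs → ⟦ t ⟧T xs ≈ f xs)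

module _ {c ℓ m ℓm} {F : Field c ℓ} (𝕍 : VectorSpace F m ℓm) where
  open Field F using (Carrier; _≈_; 0#)
  open Module 𝕍 using (Carrierᴹ; _+ᴹ_; _*ₗ_; 0ᴹ)

  data LinOp : Set (c ⊔ ℓ) where
    plus  : LinOp
    scale : (r : Carrier) → ¬ (r ≈ 0#) → LinOp

  linArity : LinOp → ℕ
  linArity plus        = 2
  linArity (scale _ _) = 1

  linInterp : (g : LinOp) → Vector Carrierᴹ (linArity g) → Carrierᴹ
  linInterp plus        xs = xs zero +ᴹ xs (suc zero)
  linInterp (scale r _) xs = r *ₗ xs zero

  LinAlg : HomAlgebra m (c ⊔ ℓ)
  LinAlg = record { V = Carrierᴹ ; Op = LinOp ; arity = linArity ; ⟦_⟧op = linInterp }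

  linComb : ∀ {n} → Vector Carrier n → Vector Carrierᴹ n → Carrierᴹ
  linComb {zero}  r xs = 0ᴹ
  linComb {suc n} r xs = (r zero *ₗ xs zero) +ᴹ linComb (r ∘ suc) (xs ∘ suc)

-- An orderly term denotes a linear form: at a node, the coefficient vector is the
-- concatenation over the blocks of the subterms' coefficient vectors, scaled by the
-- coefficient the operation puts on that argument (1 for +, r for f_r). Products of
-- nonzero scalars are nonzero, and every operation has an argument, so every term has
-- at least one variable. Conversely r₁x₁ + … + rₙxₙ = f_{r₁}(x₁) + (r₂x₂ + … + rₙxₙ)
-- is an orderly term, by induction on n ≥ 1.

module Submission where

open import Defs
open import Level using (_⊔_)
open import Data.Nat using (ℕ; _≤_; _+_; zero; suc; s≤s; z≤n)
open import Data.Nat.Properties using (≤-trans; m≤m+n; m≤n+m; +-identityʳ)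
open import Data.Fin using (Fin; zero; suc; cast; splitAt; _↑ˡ_; _↑ʳ_)
open import Data.Fin.Properties using (toℕ-injective; toℕ-cast; toℕ-↑ˡ; cast-is-id)
open import Data.Sum using (inj₁; inj₂)
open import Data.Product using (Σ; _×_; _,_; proj₁; proj₂)
open import Data.Vec.Functional using (Vector; []; _∷_; _++_; tail; take; drop; map)
open import Data.Vec.Functional.Relation.Unary.All using (All)
open import Data.Vec.Functional.Relation.Unary.All.Properties using (++⁺)
open import Relation.Nullary using (¬_)
open import Function using (_∘_)
open import Function.Bundles using (_⇔_; mk⇔)
open import Algebra.Module.Bundles using (Module)
open import Relation.Binary.PropositionalEquality as ≡ using (_≡_; _≗_; refl)
import Relation.Binary.Reasoning.Setoid as SetoidReasoning

tail-++ : ∀ {a} {A : Set a} {m n} (u : Vector A (suc m)) (v : Vector A n) →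
          tail (u ++ v) ≗ tail u ++ v
tail-++ {m = m} u v i with splitAt m i
... | inj₁ _ = refl
... | inj₂ _ = refl

concatBlocks : ∀ {a} {A : Set a} {k} (ns : Fin k → ℕ) →
               ((i : Fin k) → Vector A (ns i)) → Vector A (ΣN ns)
concatBlocks {k = zero}  ns rs = []
concatBlocks {k = suc k} ns rs = rs zero ++ concatBlocks (ns ∘ suc) (rs ∘ suc)

concatBlocks⁺ : ∀ {a p} {A : Set a} (P : A → Set p) {k} (ns : Fin k → ℕ)
                {rs : (i : Fin k) → Vector A (ns i)} →
                (∀ i → All P (rs i)) → All P (concatBlocks ns rs)
concatBlocks⁺ P {zero}  ns ps ()
concatBlocks⁺ P {suc k} ns ps = ++⁺ P (ps zero) (concatBlocks⁺ P (ns ∘ suc) (ps ∘ suc))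

blockSize≤ΣN : ∀ {k} (ns : Fin k → ℕ) i → ns i ≤ ΣN ns
blockSize≤ΣN ns zero    = m≤m+n (ns zero) _
blockSize≤ΣN ns (suc i) = ≤-trans (blockSize≤ΣN (ns ∘ suc) i) (m≤n+m _ (ns zero))

blocks-cong : ∀ {a} {A : Set a} {k} (ns : Fin k → ℕ) {xs ys : Vector A (ΣN ns)} →
              xs ≗ ys → ∀ i → blocks ns xs i ≗ blocks ns ys i
blocks-cong ns xs≗ys zero    j = xs≗ys _
blocks-cong ns xs≗ys (suc i) j = blocks-cong (ns ∘ suc) (xs≗ys ∘ (ns zero ↑ʳ_)) i j

cast-↑ˡ-0 : ∀ {m} .(eq : m + 0 ≡ m) (i : Fin m) → cast eq (i ↑ˡ 0) ≡ i
cast-↑ˡ-0 eq i = toℕ-injective (≡.trans (toℕ-cast eq (i ↑ˡ 0)) (toℕ-↑ˡ i 0))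

module _ {v o} (𝔸 : HomAlgebra v o) where
  open HomAlgebra 𝔸

  private
    ⟦_⟧ : ∀ {n} → OTerm 𝔸 n → Vector V n → V
    ⟦_⟧ = ⟦_⟧T 𝔸

  -- Without function extensionality this has to be assumed of the operations.
  OpsExtensional : Set (v ⊔ o)
  OpsExtensional = ∀ g {xs ys} → xs ≗ ys → ⟦ g ⟧op xs ≡ ⟦ g ⟧op ys

  ⟦⟧T-cong : OpsExtensional → ∀ {n} (t : OTerm 𝔸 n) {xs ys} → xs ≗ ys → ⟦ t ⟧ xs ≡ ⟦ t ⟧ ys
  ⟦⟧T-cong ext idT            xs≗ys = xs≗ys zero
  ⟦⟧T-cong ext (node g ns ts) xs≗ys =
    ext g (λ i → ⟦⟧T-cong ext (ts i) (blocks-cong ns xs≗ys i))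

  ⟦⟧T-subst : OpsExtensional → ∀ {m n} (eq : m ≡ n) (t : OTerm 𝔸 m) xs →
              ⟦ ≡.subst (OTerm 𝔸) eq t ⟧ xs ≡ ⟦ t ⟧ (xs ∘ cast eq)
  ⟦⟧T-subst ext refl t xs = ⟦⟧T-cong ext t (λ i → ≡.cong xs (≡.sym (cast-is-id refl i)))

  1≤arity : (∀ g → Fin (arity g)) → ∀ {n} → OTerm 𝔸 n → 1 ≤ n
  1≤arity someArg idT            = s≤s z≤n
  1≤arity someArg (node g ns ts) =
    ≤-trans (1≤arity someArg (ts (someArg g))) (blockSize≤ΣN ns (someArg g))

module _ {c ℓ} (F : Field c ℓ) where
  open Field F

  x≉0∧y≉0⇒x*y≉0 : ∀ {x y} → ¬ x ≈ 0# → ¬ y ≈ 0# → ¬ (x * y) ≈ 0#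
  x≉0∧y≉0⇒x*y≉0 {x} {y} x≉0 y≉0 xy≈0 with inverse x x≉0
  ... | x⁻¹ , xx⁻¹≈1 = y≉0 (begin
      y              ≈⟨ sym (*-identityˡ y) ⟩
      1# * y         ≈⟨ *-congʳ (sym xx⁻¹≈1) ⟩
      (x * x⁻¹) * y  ≈⟨ *-congʳ (*-comm x x⁻¹) ⟩
      (x⁻¹ * x) * y  ≈⟨ *-assoc x⁻¹ x y ⟩
      x⁻¹ * (x * y)  ≈⟨ *-congˡ xy≈0 ⟩
      x⁻¹ * 0#       ≈⟨ zeroʳ x⁻¹ ⟩
      0#             ∎)
    where open SetoidReasoning setoid

  1≉0 : ¬ 1# ≈ 0#
  1≉0 1≈0 = 0≉1 (sym 1≈0)

module _ {c ℓ m ℓm} {F : Field c ℓ} (𝕍 : VectorSpace F m ℓm) where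
  open Field F using (Carrier; _≈_; _*_; 0#; 1#)
  open Module 𝕍

  private
    𝔸 : HomAlgebra m (c ⊔ ℓ)
    𝔸 = LinAlg {F = F} 𝕍

    lc : ∀ {n} → Vector Carrier n → Vector Carrierᴹ n → Carrierᴹ
    lc = linComb {F = F} 𝕍

  Nonzero : Carrier → Set ℓ
  Nonzero x = ¬ x ≈ 0#

  NonzeroLinComb : ∀ {n} → (Vector Carrierᴹ n → Carrierᴹ) → Set (c ⊔ ℓ ⊔ m ⊔ ℓm)
  NonzeroLinComb {n} f =
    Σ (Vector Carrier n) λ r → All Nonzero r × (∀ xs → f xs ≈ᴹ lc r xs)

  linComb-congˡ : ∀ {n} {r s : Vector Carrier n} → r ≗ s → ∀ xs → lc r xs ≡ lc s xs
  linComb-congˡ {zero}  r≗s xs = refl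
  linComb-congˡ {suc n} r≗s xs =
    ≡.cong₂ _+ᴹ_ (≡.cong (_*ₗ xs zero) (r≗s zero)) (linComb-congˡ (r≗s ∘ suc) (xs ∘ suc))

  linComb-congʳ : ∀ {n} (r : Vector Carrier n) {xs ys} →
                  (∀ i → xs i ≈ᴹ ys i) → lc r xs ≈ᴹ lc r ys
  linComb-congʳ {zero}  r xs≈ys = ≈ᴹ-refl
  linComb-congʳ {suc n} r xs≈ys =
    +ᴹ-cong (*ₗ-congˡ (xs≈ys zero)) (linComb-congʳ (r ∘ suc) (xs≈ys ∘ suc))

  linComb-++ : ∀ {a b} (u : Vector Carrier a) (v : Vector Carrier b) xs →
               lc (u ++ v) xs ≈ᴹ lc u (take a xs) +ᴹ lc v (drop a xs)
  linComb-++ {zero}  u v xs = ≈ᴹ-sym (+ᴹ-identityˡ _)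
  linComb-++ {suc a} u v xs = begin
    u zero *ₗ xs zero +ᴹ lc (tail (u ++ v)) (tail xs)
      ≡⟨ ≡.cong (u zero *ₗ xs zero +ᴹ_) (linComb-congˡ (tail-++ u v) (tail xs)) ⟩
    u zero *ₗ xs zero +ᴹ lc (tail u ++ v) (tail xs)
      ≈⟨ +ᴹ-congˡ (linComb-++ (tail u) v (tail xs)) ⟩
    u zero *ₗ xs zero +ᴹ (lc (tail u) (take a (tail xs)) +ᴹ lc v (drop a (tail xs)))
      ≈⟨ ≈ᴹ-sym (+ᴹ-assoc _ _ _) ⟩
    lc u (take (suc a) xs) +ᴹ lc v (drop (suc a) xs) ∎
    where open SetoidReasoning ≈ᴹ-setoid

  *ₗ-linComb : ∀ {n} x (r : Vector Carrier n) xs → x *ₗ lc r xs ≈ᴹ lc (map (x *_) r) xs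
  *ₗ-linComb {zero}  x r xs = *ₗ-zeroʳ x
  *ₗ-linComb {suc n} x r xs = ≈ᴹ-trans (*ₗ-distribˡ x _ _)
    (+ᴹ-cong (≈ᴹ-sym (*ₗ-assoc x (r zero) (xs zero))) (*ₗ-linComb x (r ∘ suc) (xs ∘ suc)))

  linComb-concatBlocks : ∀ {k} (ns : Fin k → ℕ) (c : Vector Carrier k)
                         (rs : (i : Fin k) → Vector Carrier (ns i)) xs →
                         lc (concatBlocks ns (λ i → map (c i *_) (rs i))) xs
                           ≈ᴹ lc c (λ i → lc (rs i) (blocks ns xs i))
  linComb-concatBlocks {zero}  ns c rs xs = ≈ᴹ-refl
  linComb-concatBlocks {suc k} ns c rs xs = begin
    lc (map (c zero *_) (rs zero) ++ concatBlocks (ns ∘ suc) _) xs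
      ≈⟨ linComb-++ (map (c zero *_) (rs zero)) _ xs ⟩
    lc (map (c zero *_) (rs zero)) (take (ns zero) xs)
      +ᴹ lc (concatBlocks (ns ∘ suc) _) (drop (ns zero) xs)
      ≈⟨ +ᴹ-cong (≈ᴹ-sym (*ₗ-linComb (c zero) (rs zero) _))
                 (linComb-concatBlocks (ns ∘ suc) (c ∘ suc) (rs ∘ suc) _) ⟩
    lc c (λ i → lc (rs i) (blocks ns xs i)) ∎
    where open SetoidReasoning ≈ᴹ-setoid

  nonzeroLinComb-∘blocks : ∀ {k} {f : Vector Carrierᴹ k → Carrierᴹ} (ns : Fin k → ℕ)
                           {hs : (i : Fin k) → Vector Carrierᴹ (ns i) → Carrierᴹ} →
                           NonzeroLinComb f → (∀ i → NonzeroLinComb (hs i)) →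
                           NonzeroLinComb (λ xs → f (λ i → hs i (blocks ns xs i)))
  nonzeroLinComb-∘blocks {f = f} ns {hs} (c , c≉0 , f≈c) hs-lin =
    concatBlocks ns (λ i → map (c i *_) (rs i)) ,
    concatBlocks⁺ Nonzero ns (λ i j → x≉0∧y≉0⇒x*y≉0 F (c≉0 i) (rs≉0 i j)) ,
    λ xs → begin
      f (λ i → hs i (blocks ns xs i))            ≈⟨ f≈c _ ⟩
      lc c (λ i → hs i (blocks ns xs i))         ≈⟨ linComb-congʳ c (λ i → hs≈rs i _) ⟩
      lc c (λ i → lc (rs i) (blocks ns xs i))    ≈⟨ ≈ᴹ-sym (linComb-concatBlocks ns c rs xs) ⟩
      lc (concatBlocks ns (λ i → map (c i *_) (rs i))) xs ∎
    where
      open SetoidReasoning ≈ᴹ-setoid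
      rs : (i : Fin _) → Vector Carrier (ns i)
      rs i = proj₁ (hs-lin i)
      rs≉0 : ∀ i → All Nonzero (rs i)
      rs≉0 i = proj₁ (proj₂ (hs-lin i))
      hs≈rs : ∀ i xs → hs i xs ≈ᴹ lc (rs i) xs
      hs≈rs i = proj₂ (proj₂ (hs-lin i))

  ⟦⟧op-nonzeroLinComb : ∀ g → NonzeroLinComb (HomAlgebra.⟦_⟧op 𝔸 g)
  ⟦⟧op-nonzeroLinComb plus =
    (1# ∷ 1# ∷ []) , (λ { zero → 1≉0 F ; (suc zero) → 1≉0 F }) ,
    λ xs → +ᴹ-cong (≈ᴹ-sym (*ₗ-identityˡ _))
                   (≈ᴹ-sym (≈ᴹ-trans (+ᴹ-identityʳ _) (*ₗ-identityˡ _)))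
  ⟦⟧op-nonzeroLinComb (scale r r≉0) =
    (r ∷ []) , (λ { zero → r≉0 }) , λ xs → ≈ᴹ-sym (+ᴹ-identityʳ _)

  ⟦⟧T-nonzeroLinComb : ∀ {n} (t : OTerm 𝔸 n) → NonzeroLinComb (⟦_⟧T 𝔸 t)
  ⟦⟧T-nonzeroLinComb idT =
    (1# ∷ []) , (λ { zero → 1≉0 F }) ,
    λ xs → ≈ᴹ-sym (≈ᴹ-trans (+ᴹ-identityʳ _) (*ₗ-identityˡ _))
  ⟦⟧T-nonzeroLinComb (node g ns ts) =
    nonzeroLinComb-∘blocks ns (⟦⟧op-nonzeroLinComb g) (λ i → ⟦⟧T-nonzeroLinComb (ts i))

  linOps-extensional : OpsExtensional 𝔸
  linOps-extensional plus        xs≗ys = ≡.cong₂ _+ᴹ_ (xs≗ys zero) (xs≗ys (suc zero))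
  linOps-extensional (scale r _) xs≗ys = ≡.cong (r *ₗ_) (xs≗ys zero)

  scaleT : ∀ r → Nonzero r → OTerm 𝔸 1
  scaleT r r≉0 = node (scale r r≉0) (λ _ → 1) (λ _ → idT)

  linComb-inOT : ∀ {k} (r : Vector Carrier (suc k)) → All Nonzero r →
                 InOT 𝔸 _≈ᴹ_ (lc r)
  linComb-inOT {zero}  r r≉0 = scaleT (r zero) (r≉0 zero) , λ xs → ≈ᴹ-sym (+ᴹ-identityʳ _)
  linComb-inOT {suc k} r r≉0 with linComb-inOT (tail r) (r≉0 ∘ suc)
  ... | t , t≈r = ≡.subst (OTerm 𝔸) arity≡ headPlusTail , λ xs → begin
      ⟦_⟧T 𝔸 (≡.subst (OTerm 𝔸) arity≡ headPlusTail) xs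
        ≡⟨ ⟦⟧T-subst 𝔸 linOps-extensional arity≡ headPlusTail xs ⟩
      r zero *ₗ xs zero +ᴹ ⟦_⟧T 𝔸 t (λ i → xs (suc (cast _ (i ↑ˡ 0))))
        ≡⟨ ≡.cong (r zero *ₗ xs zero +ᴹ_) (⟦⟧T-cong 𝔸 linOps-extensional t
             (λ i → ≡.cong (xs ∘ suc) (cast-↑ˡ-0 _ i))) ⟩
      r zero *ₗ xs zero +ᴹ ⟦_⟧T 𝔸 t (tail xs)
        ≈⟨ +ᴹ-congˡ (t≈r (tail xs)) ⟩
      lc r xs ∎
    where
      open SetoidReasoning ≈ᴹ-setoid
      -- ΣN ends in + 0, so the plus node has arity 1 + (suc k + 0), not suc (suc k).
      arity≡ : 1 + (suc k + 0) ≡ suc (suc k)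
      arity≡ = ≡.cong suc (+-identityʳ (suc k))
      ns : Fin 2 → ℕ
      ns zero       = 1
      ns (suc zero) = suc k
      headPlusTail : OTerm 𝔸 (ΣN ns)
      headPlusTail = node plus ns λ { zero → scaleT (r zero) (r≉0 zero) ; (suc zero) → t }

  inOT⇒nonzeroLinComb : ∀ {n} {f : Vector Carrierᴹ n → Carrierᴹ} →
                        InOT 𝔸 _≈ᴹ_ f → 1 ≤ n × NonzeroLinComb f
  inOT⇒nonzeroLinComb (t , t≈f) with ⟦⟧T-nonzeroLinComb t
  ... | r , r≉0 , t≈r =
    1≤arity 𝔸 (λ { plus → zero ; (scale _ _) → zero }) t ,
    r , r≉0 , λ xs → ≈ᴹ-trans (≈ᴹ-sym (t≈f xs)) (t≈r xs)

  nonzeroLinComb⇒inOT : ∀ {n} {f : Vector Carrierᴹ n → Carrierᴹ} →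
                        1 ≤ n × NonzeroLinComb f → InOT 𝔸 _≈ᴹ_ f
  nonzeroLinComb⇒inOT (s≤s z≤n , r , r≉0 , f≈r) with linComb-inOT r r≉0
  ... | t , t≈r = t , λ xs → ≈ᴹ-trans (t≈r xs) (≈ᴹ-sym (f≈r xs))

lemma7p1 : ∀ {c ℓ m ℓm} (F : Field c ℓ) (𝕍 : VectorSpace F m ℓm)
             (n : ℕ) (f : (Fin n → Module.Carrierᴹ 𝕍) → Module.Carrierᴹ 𝕍) →
             InOT (LinAlg {F = F} 𝕍) (Module._≈ᴹ_ 𝕍) f
               ⇔ (1 ≤ n × Σ (Fin n → Field.Carrier F) (λ r →
                    ((i : Fin n) → ¬ (Field._≈_ F (r i) (Field.0# F)))
                      × (∀ xs → Module._≈ᴹ_ 𝕍 (f xs) (linComb {F = F} 𝕍 r xs))))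
lemma7p1 F 𝕍 n f = mk⇔ (inOT⇒nonzeroLinComb 𝕍) (nonzeroLinComb⇒inOT 𝕍)
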